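{- For every graph $G$ and all integers $q,m \geq 2$, $D_q(D_m(G)) \cong D_{qm}(G)$.
   Context: For a graph $G$ with $V(G)=\{v_1,\dots,v_n\}$ and a positive integer $m$, the $m$-th shadow graph $D_m(G)$ has vertex set $\{v^i_j : i\in[m], j\in[n]\}$, with $v^i_j \sim v^k_l$ iff $v_j\sim v_l$ in $G$ (for any $i,k\in[m]$). -}

module Defs where

open import Level using (Level; suc; _⊔_)
open import Data.Nat using (ℕ; _*_)
open import Data.Fin using (Fin; remQuot)
open import Data.Product using (Σ; proj₂; _×_)
open import Relation.Nullary using (¬_)
open import Relation.Binary.PropositionalEquality using (_≡_)
open import Function.Bundles using (_⤖_; _⇔_; Bijection)

record Graph (ℓ : Level) : Set (suc ℓ) where
  field
    n      : ℕ
    Adj    : Fin n → Fin n → Set ℓ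
    sym    : ∀ {x y} → Adj x y → Adj y x
    irrefl : ∀ {x} → ¬ Adj x x
open Graph public

-- The m-th shadow graph D_m(G).  Vertex v^i_j (i ∈ Fin m, j ∈ Fin n) is
-- encoded as the index  combine i j : Fin (m * n), decoded by remQuot.
-- v^i_j ~ v^k_l  iff  v_j ~ v_l in G.
shadow : ∀ {ℓ} → ℕ → Graph ℓ → Graph ℓ
shadow m G = record
  { n      = m * n G
  ; Adj    = λ x y → Adj G (proj₂ (remQuot {m} (n G) x)) (proj₂ (remQuot {m} (n G) y))
  ; sym    = sym G
  ; irrefl = irrefl G
  }

_≅_ : ∀ {ℓ} → Graph ℓ → Graph ℓ → Set ℓ
G ≅ H = Σ (Fin (n G) ⤖ Fin (n H)) λ f →
          ∀ x y → Adj G x y ⇔ Adj H (Bijection.to f x) (Bijection.to f y)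

{-# OPTIONS --safe #-}
-- A vertex of D_q(D_m(G)) is a triple (a, b, v) ∈ [q] × [m] × V(G) whose adjacency depends only
-- on v, and a vertex of D_{qm}(G) is a pair (c, v) ∈ [qm] × V(G) with the same property. Merging
-- (a, b) into one index c is a bijection that leaves v untouched, hence an isomorphism.
module Submission where

open import Defs
open import Level using (Level; 0ℓ)
open import Data.Nat using (ℕ; _*_; _≤_)
open import Data.Fin using (Fin; remQuot)
open import Data.Fin.Properties using (*↔×; remQuot-combine)
open import Data.Product using (_×_; _,_; proj₂)
open import Data.Product.Algebra using (×-cong; ×-assoc)
open import Function using (_∘_; _↔_; Inverse)
open import Function.Properties.Inverse using (↔-refl; ↔⇒⤖)
open import Function.Related.Propositional using (≡⇒; bijection; module EquationalReasoning)
open import Relation.Binary.PropositionalEquality as ≡ using (_≡_; cong; cong₂)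

base : ∀ m {k} → Fin (m * k) → Fin k
base m {k} = proj₂ ∘ remQuot {m} k

*-assoc↔ : ∀ q m k → Fin (q * (m * k)) ↔ Fin (q * m * k)
*-assoc↔ q m k = begin
  Fin (q * (m * k))         ↔⟨ *↔× ⟩
  (Fin q × Fin (m * k))     ↔⟨ ×-cong ↔-refl *↔× ⟩
  (Fin q × (Fin m × Fin k)) ↔⟨ ×-assoc 0ℓ _ _ _ ⟨
  ((Fin q × Fin m) × Fin k) ↔⟨ ×-cong *↔× ↔-refl ⟨
  (Fin (q * m) × Fin k)     ↔⟨ *↔× ⟨
  Fin (q * m * k)           ∎
  where open EquationalReasoning {k = bijection}

base-*-assoc↔ : ∀ q m k (x : Fin (q * (m * k))) →
                base (q * m) (Inverse.to (*-assoc↔ q m k) x) ≡ base m (base q x)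
-- *-assoc↔ computes to combine (combine a b) j, where (a , (b , j)) is the decoding of x.
base-*-assoc↔ q m k x = cong proj₂ (remQuot-combine {q * m} {k} _ _)

shadow-shadow-≅ : ∀ {ℓ} (G : Graph ℓ) q m → shadow q (shadow m G) ≅ shadow (q * m) G
shadow-shadow-≅ G q m = ↔⇒⤖ (*-assoc↔ q m (n G)) , λ x y →
  ≡⇒ (cong₂ (Adj G) (≡.sym (base-*-assoc↔ q m (n G) x)) (≡.sym (base-*-assoc↔ q m (n G) y)))

theorem10 : ∀ {ℓ : Level} (G : Graph ℓ) (q m : ℕ) → 2 ≤ q → 2 ≤ m →
    shadow q (shadow m G) ≅ shadow (q * m) G
theorem10 G q m _ _ = shadow-shadow-≅ G q m
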